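{- Let algorithm \textsf{R} (defined below) be run on a connected undirected graph with vertex set $[n]$, $n\ge2$. Let $k>2$ be an integer and let $T_1,T_2$ be distinct trees that are passive in round $k-1$. Then the \textsc{parent-connect}/\textsc{root-update} of round $k$ does not link $T_1$ and $T_2$, and there is no edge with one end in $T_1$ and the other end in $T_2$.
   Context: Each edge $e$ has two ends $e.v,e.w$ (edges never change). Each vertex $v$ has a parent $v.p$, initially $v$; $v$ is a root if $v.p=v$. The parent pointers form a forest (the label forest). Vertices are compared as integers. Each operation is performed simultaneously for all edges/vertices using values at the start of the operation. \textsc{parent-connect}: for each edge $e$, let $x=e.v.p$, $y=e.w.p$; send $\min\{x,y\}$ to $\max\{x,y\}$. \textsc{root-update}: for each root $v$, replace $v.p$ by the minimum of $v.p$ and the vertices sent to $v$ in the preceding \textsc{parent-connect}. \textsc{shortcut}: for each vertex $v$, replace $v.p$ by $(v.p).p$. Algorithm \textsf{R}: repeat \{\textsc{parent-connect}; \textsc{root-update}; \textsc{shortcut}\} until no parent changes; iterations are rounds $1,2,\dots$. A tree in round $k$ means a tree of the label forest at the end of round $k$. For $k>2$, a tree in round $k$ is passive in round $k$ if it already existed (with the same vertices and parents) at the beginning of round $k$, and active otherwise; all trees in round $2$ are active. The connect step of a round links trees $T_1$ and $T_2$ if it makes the root of one of them a child of a vertex of the other. -}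

module Defs where

open import Data.Nat using (ℕ; zero; suc; _<_; _≤?_; _∸_)
open import Data.Fin using (Fin; toℕ)
open import Data.Fin.Properties using (_≟_)
open import Data.Bool using (if_then_else_)
open import Data.Product using (_×_; _,_; Σ; ∃-syntax)
open import Data.Sum using (_⊎_)
open import Data.List using (List; foldr)
open import Data.List.Membership.Propositional using (_∈_)
open import Relation.Binary.PropositionalEquality using (_≡_; _≢_)
open import Relation.Nullary using (does)
open import Function.Bundles using (_⇔_)

-- An edge e has two ends (e.v , e.w); vertices are Fin n, compared via toℕ.
Edge : ℕ → Set
Edge n = Fin n × Fin n

Parents : ℕ → Set
Parents n = Fin n → Fin n

module _ {n : ℕ} where

  minF : Fin n → Fin n → Fin n
  minF x y = if does (toℕ x ≤? toℕ y) then x else y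

  maxF : Fin n → Fin n → Fin n
  maxF x y = if does (toℕ x ≤? toℕ y) then y else x

  -- PARENT-CONNECT: edge e = (v , w) sends min{v.p, w.p} to max{v.p, w.p}.
  -- Result: (value sent , recipient).
  sendOf : Parents n → Edge n → Fin n × Fin n
  sendOf p (v , w) = minF (p v) (p w) , maxF (p v) (p w)

  minReceived : List (Edge n) → Parents n → Fin n → Fin n → Fin n
  minReceived es p u acc =
    foldr (λ e a → let (x , y) = sendOf p e in
                   if does (y ≟ u) then minF a x else a) acc es

  IsRoot : Parents n → Fin n → Set
  IsRoot p v = p v ≡ v

  -- PARENT-CONNECT followed by ROOT-UPDATE (the connect step)
  connectStep : List (Edge n) → Parents n → Parents n
  connectStep es p v =
    if does (p v ≟ v) then minReceived es p v (p v) else p v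

  shortcut : Parents n → Parents n
  shortcut p v = p (p v)

  roundR : List (Edge n) → Parents n → Parents n
  roundR es p = shortcut (connectStep es p)

  stateAfter : List (Edge n) → ℕ → Parents n
  stateAfter es zero    = λ v → v
  stateAfter es (suc j) = roundR es (stateAfter es j)

  iter : Parents n → ℕ → Fin n → Fin n
  iter p zero    v = v
  iter p (suc m) v = p (iter p m v)

  InTree : Parents n → Fin n → Fin n → Set
  InTree p r v = IsRoot p r × ∃[ m ] iter p m v ≡ r

  -- the tree with root r in round j is passive in round j (j > 2):
  -- the same tree (same vertices, same parents) existed at the end of round j-1
  Passive : List (Edge n) → ℕ → Fin n → Set
  Passive es j r =
    2 < j × IsRoot (stateAfter es j) r ×
    Σ (Fin n) (λ r' → IsRoot (stateAfter es (j ∸ 1)) r' ×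
      (∀ v → InTree (stateAfter es j) r v ⇔ InTree (stateAfter es (j ∸ 1)) r' v) ×
      (∀ v → InTree (stateAfter es j) r v → stateAfter es j v ≡ stateAfter es (j ∸ 1) v))

  -- round k is executed: each of rounds 1, ..., k-1 changed some parent
  RoundExecuted : List (Edge n) → ℕ → Set
  RoundExecuted es k =
    ∀ j → j < k ∸ 1 → ∃[ v ] stateAfter es (suc j) v ≢ stateAfter es j v

  -- the connect step of round k links the trees (of the forest at the end of
  -- round k-1) with roots r₁ and r₂: the root of one becomes a child of a
  -- vertex of the other
  Links : List (Edge n) → ℕ → Fin n → Fin n → Set
  Links es k r₁ r₂ =
    InTree P r₂ (Q r₁) ⊎ InTree P r₁ (Q r₂)
    where
      P = stateAfter es (k ∸ 1)
      Q = connectStep es P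

  data Reach (es : List (Edge n)) : Fin n → Fin n → Set where
    here : ∀ {u} → Reach es u u
    fwd  : ∀ {u v w} → (v , w) ∈ es → Reach es w u → Reach es v u
    bwd  : ∀ {u v w} → (v , w) ∈ es → Reach es v u → Reach es w u

  Connected : List (Edge n) → Set
  Connected es = ∀ u v → Reach es u v

module Submission where

-- Fix a round and write P for the forest at its start, Q for the
-- forest after its connect step and S = shortcut Q for the forest at its end.
-- Call the tree of r "unchanged" if it is a tree of S that was already a tree
-- of P with the same parents (this is what passivity in the round says).
--  * An unchanged tree is flat in P (every vertex hangs directly below r):
--    shortcutting would otherwise have moved a grandchild.
--  * Its root is stable: Q r ≡ r, since a new parent of r would survive the
--    shortcut or make r's tree change.
--  * Two distinct stable roots are never joined by an edge between their
--    children: that edge would send the smaller root to the larger one.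
--  * In the next round the connect step can only hang a root r₁ below a tree
--    of r₂ through an edge between the two trees.

open import Defs
open import Data.Nat using (ℕ; _≤_; _<_; _∸_; zero; suc; s≤s; _≤?_)
open import Data.Nat.Properties using (≤-refl; ≤-trans; ≤-antisym; ≰⇒>; <⇒≤; <⇒≱)
open import Data.Fin using (Fin; toℕ)
open import Data.Fin.Properties using (_≟_; toℕ-injective)
open import Data.Bool using (if_then_else_)
open import Data.Product using (_×_; _,_; ∃-syntax)
open import Data.Sum using (_⊎_; inj₁; inj₂)
open import Data.List using (List; []; _∷_)
open import Data.List.Membership.Propositional using (_∈_)
open import Data.List.Relation.Unary.Any using (here; there)
open import Data.Empty using (⊥-elim)
open import Relation.Binary.PropositionalEquality
  using (_≡_; _≢_; refl; sym; trans; cong; cong₂; subst; subst₂)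
open import Relation.Nullary using (¬_; Dec; yes; no; does)
open import Relation.Nullary.Decidable using (dec-true; dec-false)
open import Function.Bundles using (_⇔_; Equivalence)

module _ {n : ℕ} where

  data MinMax (x y : Fin n) : Set where
    ordered : toℕ x ≤ toℕ y → minF x y ≡ x → maxF x y ≡ y → MinMax x y
    swapped : toℕ y < toℕ x → minF x y ≡ y → maxF x y ≡ x → MinMax x y

  minmax : (x y : Fin n) → MinMax x y
  minmax x y with toℕ x ≤? toℕ y
  ... | yes x≤y = ordered x≤y (cong (λ b → if b then x else y) (dec-true (toℕ x ≤? toℕ y) x≤y))
                              (cong (λ b → if b then y else x) (dec-true (toℕ x ≤? toℕ y) x≤y))
  ... | no x≰y  = swapped (≰⇒> x≰y) (cong (λ b → if b then x else y) (dec-false (toℕ x ≤? toℕ y) x≰y))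
                                    (cong (λ b → if b then y else x) (dec-false (toℕ x ≤? toℕ y) x≰y))

  minF≤ˡ : (x y : Fin n) → toℕ (minF x y) ≤ toℕ x
  minF≤ˡ x y with minmax x y
  ... | ordered _ mn _   rewrite mn = ≤-refl
  ... | swapped y<x mn _ rewrite mn = <⇒≤ y<x

  minF≤ʳ : (x y : Fin n) → toℕ (minF x y) ≤ toℕ y
  minF≤ʳ x y with minmax x y
  ... | ordered x≤y mn _ rewrite mn = x≤y
  ... | swapped _ mn _   rewrite mn = ≤-refl

  minF-selects : (x y : Fin n) → minF x y ≡ x ⊎ minF x y ≡ y
  minF-selects x y with minmax x y
  ... | ordered _ mn _ = inj₁ mn
  ... | swapped _ mn _ = inj₂ mn

  Sends : List (Edge n) → Parents n → Fin n → Fin n → Set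
  Sends es p z u =
    ∃[ a ] ∃[ b ] (a , b) ∈ es × minF (p a) (p b) ≡ z × maxF (p a) (p b) ≡ u

  sends-∷ : ∀ {es p z u} e → Sends es p z u → Sends (e ∷ es) p z u
  sends-∷ e (a , b , ab∈es , mn , mx) = a , b , there ab∈es , mn , mx

  sender-ends : ∀ {es p z u} → Sends es p z u →
    ∃[ a ] ∃[ b ] (a , b) ∈ es × ((p a ≡ z × p b ≡ u) ⊎ (p a ≡ u × p b ≡ z))
  sender-ends {p = p} (a , b , ab∈es , refl , refl) with minmax (p a) (p b)
  ... | ordered _ mn mx = a , b , ab∈es , inj₁ (sym mn , sym mx)
  ... | swapped _ mn mx = a , b , ab∈es , inj₂ (sym mx , sym mn)

  sent-is-label : ∀ {es p z u} → Sends es p z u → ∃[ c ] p c ≡ z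
  sent-is-label {p = p} (a , b , _ , mn , _) with minF-selects (p a) (p b)
  ... | inj₁ min-a = a , trans (sym min-a) mn
  ... | inj₂ min-b = b , trans (sym min-b) mn

  step≤ : ∀ {A : Set} (d : Dec A) (acc z : Fin n) →
    toℕ (if does d then minF acc z else acc) ≤ toℕ acc
  step≤ (yes _) acc z = minF≤ˡ acc z
  step≤ (no _)  acc z = ≤-refl

  minReceived≤acc : ∀ es (p : Parents n) u acc → toℕ (minReceived es p u acc) ≤ toℕ acc
  minReceived≤acc []            p u acc = ≤-refl
  minReceived≤acc ((a , b) ∷ es) p u acc =
    ≤-trans (step≤ (maxF (p a) (p b) ≟ u) (minReceived es p u acc) (minF (p a) (p b)))
            (minReceived≤acc es p u acc)

  minReceived≤sent : ∀ es (p : Parents n) {z u} acc → Sends es p z u →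
    toℕ (minReceived es p u acc) ≤ toℕ z
  minReceived≤sent ((a , b) ∷ es) p acc (_ , _ , here refl , refl , refl) =
    received (maxF (p a) (p b) ≟ maxF (p a) (p b))
    where
      received : (d : Dec (maxF (p a) (p b) ≡ maxF (p a) (p b))) →
        let R = minReceived es p (maxF (p a) (p b)) acc
        in  toℕ (if does d then minF R (minF (p a) (p b)) else R) ≤ toℕ (minF (p a) (p b))
      received (yes _)   = minF≤ʳ (minReceived es p (maxF (p a) (p b)) acc) (minF (p a) (p b))
      received (no u≢u) = ⊥-elim (u≢u refl)
  minReceived≤sent ((a , b) ∷ es) p {u = u} acc (c , d , there cd∈es , mn , mx) =
    ≤-trans (step≤ (maxF (p a) (p b) ≟ u) (minReceived es p u acc) (minF (p a) (p b)))
            (minReceived≤sent es p acc (c , d , cd∈es , mn , mx))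

  minReceived-source : ∀ es (p : Parents n) u acc →
    minReceived es p u acc ≡ acc ⊎ Sends es p (minReceived es p u acc) u
  minReceived-source []            p u acc = inj₁ refl
  minReceived-source ((a , b) ∷ es) p u acc =
    step (maxF (p a) (p b) ≟ u) (minReceived-source es p u acc)
    where
      R = minReceived es p u acc
      step : (d : Dec (maxF (p a) (p b) ≡ u)) → R ≡ acc ⊎ Sends es p R u →
        let R′ = if does d then minF R (minF (p a) (p b)) else R
        in  R′ ≡ acc ⊎ Sends ((a , b) ∷ es) p R′ u
      step (yes sent) source with minF-selects R (minF (p a) (p b))
      ... | inj₂ head = inj₂ (a , b , here refl , sym head , sent)
      ... | inj₁ kept with source
      ...   | inj₁ R≡acc = inj₁ (trans kept R≡acc)
      ...   | inj₂ sends = inj₂ (subst (λ z → Sends _ p z u) (sym kept) (sends-∷ {p = p} _ sends))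
      step (no _) (inj₁ R≡acc) = inj₁ R≡acc
      step (no _) (inj₂ sends) = inj₂ (sends-∷ {p = p} _ sends)

  connect-root : ∀ es (P : Parents n) v → P v ≡ v → connectStep es P v ≡ minReceived es P v v
  connect-root es P v v-root =
    trans (cong (λ b → if b then minReceived es P v (P v) else P v) (dec-true (P v ≟ v) v-root))
          (cong (minReceived es P v) v-root)

  connect-nonroot : ∀ es (P : Parents n) v → P v ≢ v → connectStep es P v ≡ P v
  connect-nonroot es P v moved =
    cong (λ b → if b then minReceived es P v (P v) else P v) (dec-false (P v ≟ v) moved)

  iter-root : (p : Parents n) {r : Fin n} (m : ℕ) → p r ≡ r → iter p m r ≡ r
  iter-root p zero    r-root = refl
  iter-root p (suc m) r-root = trans (cong p (iter-root p m r-root)) r-root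

  root-in-tree : ∀ {p : Parents n} {u r} → p u ≡ u → InTree p r u → u ≡ r
  root-in-tree {p} u-root (_ , m , reach) = trans (sym (iter-root p m u-root)) reach

  child-in-tree : ∀ {p : Parents n} {r v} → InTree p r (p v) → InTree p r v
  child-in-tree {p} {r} {v} (r-root , m , reach) = r-root , suc m , trans (shift m) reach
    where
      shift : ∀ m → iter p (suc m) v ≡ iter p m (p v)
      shift zero    = refl
      shift (suc m) = cong p (shift m)

  path-of-root-child : (p : Parents n) {v : Fin n} (m : ℕ) → p (p v) ≡ p v →
    iter p m v ≡ v ⊎ iter p m v ≡ p v
  path-of-root-child p zero    _          = inj₁ refl
  path-of-root-child p (suc m) parent-root with path-of-root-child p m parent-root
  ... | inj₁ at-v      = inj₂ (cong p at-v)
  ... | inj₂ at-parent = inj₂ (trans (cong p at-parent) parent-root)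

  link⇒edge : ∀ {es} {p : Parents n} {r₁ r₂} → p r₁ ≡ r₁ → r₁ ≢ r₂ →
    InTree p r₂ (connectStep es p r₁) →
    ∃[ a ] ∃[ b ] (a , b) ∈ es ×
      ((InTree p r₁ a × InTree p r₂ b) ⊎ (InTree p r₂ a × InTree p r₁ b))
  link⇒edge {es} {p} {r₁} r₁-root r₁≢r₂ hung =
    from-source (minReceived-source es p r₁ r₁)
    where
      R = minReceived es p r₁ r₁
      hung′ : InTree p _ R
      hung′ = subst (InTree p _) (connect-root es p r₁ r₁-root) hung
      from-source : R ≡ r₁ ⊎ Sends es p R r₁ → ∃[ a ] ∃[ b ] (a , b) ∈ es ×
        ((InTree p r₁ a × InTree p _ b) ⊎ (InTree p _ a × InTree p r₁ b))
      from-source (inj₁ R≡r₁) =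
        ⊥-elim (r₁≢r₂ (root-in-tree r₁-root (subst (InTree p _) R≡r₁ hung′)))
      from-source (inj₂ sends) with sender-ends sends
      ... | a , b , ab∈es , inj₁ (pa≡R , pb≡r₁) =
        a , b , ab∈es , inj₂ (child-in-tree (subst (InTree p _) (sym pa≡R) hung′) , (r₁-root , 1 , pb≡r₁))
      ... | a , b , ab∈es , inj₂ (pa≡r₁ , pb≡R) =
        a , b , ab∈es , inj₁ ((r₁-root , 1 , pa≡r₁) , child-in-tree (subst (InTree p _) (sym pb≡R) hung′))

module Round {n : ℕ} (es : List (Edge n)) (P : Parents n) where

  Q : Parents n
  Q = connectStep es P

  S : Parents n
  S = shortcut Q

  connect-root≤ : ∀ {u} → P u ≡ u → toℕ (Q u) ≤ toℕ u
  connect-root≤ {u} u-root =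
    subst (λ z → toℕ z ≤ toℕ u) (sym (connect-root es P u u-root)) (minReceived≤acc es P u u)

  -- A vertex whose parent after the connect step is itself was already a root of P,
  -- because the connect step does not move the parents of non-roots.
  fixed⇒root : ∀ {u} → Q u ≡ u → P u ≡ u
  fixed⇒root {u} fixed = by-test (P u ≟ u)
    where
      by-test : Dec (P u ≡ u) → P u ≡ u
      by-test (yes u-root) = u-root
      by-test (no moved)   = trans (sym (connect-nonroot es P u moved)) fixed

  stable-root-receives : ∀ {z u} → P u ≡ u → Q u ≡ u → Sends es P z u → toℕ u ≤ toℕ z
  stable-root-receives {z} {u} u-root fixed sent =
    subst (λ t → toℕ t ≤ toℕ z) (trans (sym (connect-root es P u u-root)) fixed)
          (minReceived≤sent es P u sent)

  -- Two roots kept by the connect step have no edge between their children: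
  -- the edge would send the smaller root to the larger one.
  stable-roots-unjoined : ∀ {r₁ r₂ a b} → P r₁ ≡ r₁ → Q r₁ ≡ r₁ → P r₂ ≡ r₂ → Q r₂ ≡ r₂ →
    (a , b) ∈ es → P a ≡ r₁ → P b ≡ r₂ → r₁ ≡ r₂
  stable-roots-unjoined {r₁} {r₂} {a} {b} P₁ Q₁ P₂ Q₂ ab∈es pa pb = by-order (minmax r₁ r₂)
    where
      sends : Sends es P (minF r₁ r₂) (maxF r₁ r₂)
      sends = a , b , ab∈es , cong₂ minF pa pb , cong₂ maxF pa pb
      by-order : MinMax r₁ r₂ → r₁ ≡ r₂
      by-order (ordered r₁≤r₂ mn mx) = toℕ-injective
        (≤-antisym r₁≤r₂ (stable-root-receives P₂ Q₂ (subst₂ (Sends es P) mn mx sends)))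
      by-order (swapped r₂<r₁ mn mx) = ⊥-elim
        (<⇒≱ r₂<r₁ (stable-root-receives P₁ Q₁ (subst₂ (Sends es P) mn mx sends)))

  record Unchanged (r : Fin n) : Set where
    field
      root-after  : S r ≡ r
      same-tree   : ∀ v → InTree S r v ⇔ InTree P r v
      same-parent : ∀ v → InTree S r v → S v ≡ P v

    root-before : P r ≡ r
    root-before = trans (sym (same-parent r (root-after , 0 , refl))) root-after

    -- Every parent in the tree is a root: a vertex v deeper down would have
    -- been shortcut, since the connect step does not move the non-root P v.
    parent-is-root : ∀ {v} → InTree P r v → P (P v) ≡ P v
    parent-is-root {v} v∈T = by-test (P v ≟ v)
      where
        by-test : Dec (P v ≡ v) → P (P v) ≡ P v
        by-test (yes v-root) = cong P v-root
        by-test (no moved)   = fixed⇒root (trans (cong Q (sym (connect-nonroot es P v moved)))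
                                                 (same-parent v (Equivalence.from (same-tree v) v∈T)))

    flat : ∀ {v} → InTree P r v → P v ≡ r
    flat {v} v∈T@(_ , m , reach) with path-of-root-child P m (parent-is-root v∈T)
    ... | inj₁ at-v      = trans (cong P (trans (sym at-v) reach)) root-before
    ... | inj₂ at-parent = trans (sym at-parent) reach

    flat-after : ∀ {v} → InTree S r v → P v ≡ r
    flat-after {v} v∈T = flat (Equivalence.to (same-tree v) v∈T)

    -- A new parent z = Q r
    -- would satisfy Q z ≡ r after shortcutting; if z is a root this forces
    -- r ≤ z ≤ r, otherwise z's child c lies two levels below r, against flatness.
    root-stable : Q r ≡ r
    root-stable = from-source (minReceived-source es P r r)
      where
        Qr≡R : Q r ≡ minReceived es P r r
        Qr≡R = connect-root es P r root-before
        new-parent-is-r : ∀ c → P c ≡ Q r → Dec (P (Q r) ≡ Q r) → Q r ≡ r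
        new-parent-is-r c _ (yes z-root) = toℕ-injective (≤-antisym (connect-root≤ root-before)
          (subst (λ t → toℕ t ≤ toℕ (Q r)) root-after (connect-root≤ z-root)))
        new-parent-is-r c pc≡z (no z-moved) = trans (sym pc≡z) (flat (root-before , 2 ,
          trans (cong P pc≡z) (trans (sym (connect-nonroot es P (Q r) z-moved)) root-after)))
        from-source : minReceived es P r r ≡ r ⊎ Sends es P (minReceived es P r r) r → Q r ≡ r
        from-source (inj₁ unchanged) = trans Qr≡R unchanged
        from-source (inj₂ sends) with sent-is-label sends
        ... | c , pc≡R = new-parent-is-r c (trans pc≡R (sym Qr≡R)) (P (Q r) ≟ Q r)

  open Unchanged

  -- No edge joins two distinct unchanged trees: their roots are stable and
  -- all their vertices hang directly below the roots.
  unchanged-unjoined : ∀ {r₁ r₂} → Unchanged r₁ → Unchanged r₂ → r₁ ≢ r₂ →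
    ∀ v w → (v , w) ∈ es →
    ¬ ((InTree S r₁ v × InTree S r₂ w) ⊎ (InTree S r₂ v × InTree S r₁ w))
  unchanged-unjoined u₁ u₂ r₁≢r₂ v w vw∈es (inj₁ (v∈T₁ , w∈T₂)) =
    r₁≢r₂ (stable-roots-unjoined (root-before u₁) (root-stable u₁) (root-before u₂) (root-stable u₂)
                                 vw∈es (flat-after u₁ v∈T₁) (flat-after u₂ w∈T₂))
  unchanged-unjoined u₁ u₂ r₁≢r₂ v w vw∈es (inj₂ (v∈T₂ , w∈T₁)) =
    r₁≢r₂ (sym (stable-roots-unjoined (root-before u₂) (root-stable u₂) (root-before u₁) (root-stable u₁)
                                      vw∈es (flat-after u₂ v∈T₂) (flat-after u₁ w∈T₁)))

  unchanged-unlinked : ∀ {r₁ r₂} → Unchanged r₁ → Unchanged r₂ → r₁ ≢ r₂ →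
    ¬ InTree S r₂ (connectStep es S r₁)
  unchanged-unlinked u₁ u₂ r₁≢r₂ hung with link⇒edge (root-after u₁) r₁≢r₂ hung
  ... | v , w , vw∈es , joined = unchanged-unjoined u₁ u₂ r₁≢r₂ v w vw∈es joined

passive⇒unchanged : ∀ {n} {es : List (Edge n)} {j r} →
  Passive es (suc j) r → Round.Unchanged es (stateAfter es j) r
passive⇒unchanged {es = es} {j} {r} (_ , S-root , r′ , _ , same-tree , same-parent) = record
  { root-after  = S-root
  ; same-tree   = λ v → subst (λ t → InTree S r v ⇔ InTree P t v) (sym r≡r′) (same-tree v)
  ; same-parent = same-parent
  }
  where
    P S : Parents _
    P = stateAfter es j
    S = stateAfter es (suc j)
    -- r is a root of P lying in the tree of r′, so r ≡ r′.
    r≡r′ : r ≡ r′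
    r≡r′ = root-in-tree (trans (sym (same-parent r (S-root , 0 , refl))) S-root)
                        (Equivalence.to (same-tree r) (S-root , 0 , refl))

lemma23 : (n : ℕ) → 2 ≤ n → (es : List (Edge n)) → Connected es →
    (k : ℕ) → 2 < k → RoundExecuted es k →
    (r₁ r₂ : Fin n) → r₁ ≢ r₂ →
    Passive es (k ∸ 1) r₁ → Passive es (k ∸ 1) r₂ →
    ¬ Links es k r₁ r₂ ×
    (∀ v w → (v , w) ∈ es →
      ¬ ((InTree (stateAfter es (k ∸ 1)) r₁ v × InTree (stateAfter es (k ∸ 1)) r₂ w)
         ⊎ (InTree (stateAfter es (k ∸ 1)) r₂ v × InTree (stateAfter es (k ∸ 1)) r₁ w)))
lemma23 _ _ _ _ zero          ()                _ _ _ _ _ _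
lemma23 _ _ _ _ (suc zero)    (s≤s ())          _ _ _ _ _ _
lemma23 _ _ es _ (suc (suc j)) _ _ r₁ r₂ r₁≢r₂ passive₁ passive₂ =
  no-link , unchanged-unjoined u₁ u₂ r₁≢r₂
  where
    open Round es (stateAfter es j)
    u₁ : Unchanged r₁
    u₁ = passive⇒unchanged passive₁
    u₂ : Unchanged r₂
    u₂ = passive⇒unchanged passive₂
    no-link : ¬ Links es (suc (suc j)) r₁ r₂
    no-link (inj₁ r₁-hung) = unchanged-unlinked u₁ u₂ r₁≢r₂ r₁-hung
    no-link (inj₂ r₂-hung) = unchanged-unlinked u₂ u₁ (λ r₂≡r₁ → r₁≢r₂ (sym r₂≡r₁)) r₂-hung
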